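{- Let $k\geq 4$. There exists $n_0\in\mathbb{N}$ such that for every $n\geq n_0$ and every balanced ordered $(k-1)$-partition $Q=(Q_0,\{Q_1,\dots,Q_{k-2}\})$ of $[n]$, the proportion of $k$-templates $G$ on $Q$ (with vertex set $[n]$) such that $\overline{G}[Q_0]$ has at most one non-trivial component is at most $2^{ -n}$.
   Context: An ordered $(k-1)$-partition of a set $V$ is a partition of $V$ into $k-1$ classes of which one, $Q_0$, is labelled and the others $Q_1,\dots,Q_{k-2}$ are unlabelled; it is balanced if any two class sizes differ by at most one. A graph is a sun if it is a single vertex or its vertex set can be partitioned into $A,B$ with edge set $\{uv:|\{u,v\}\cap B|\leq 1\}$. For $k\geq4$, $G$ is a $k$-template on $Q$ if $G[Q_i]$ is a clique for all $i\in[k-2]$ and: if $k=4$, $\overline{G}[Q_0]$ is a disjoint union of suns; if $k=5$, $\overline{G}[Q_0]$ is a disjoint union of stars and cliques; if $k\geq6$, $\overline{G}[Q_0]$ is a disjoint union of stars and triangles (a single vertex counts as a star and a clique). $\overline{G}$ denotes the complement. A component is non-trivial if it has at least two vertices. -}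

module Defs where

open import Data.Nat using (ℕ; zero; suc; _≤_; _+_)
open import Data.Bool using (Bool; true; false)
open import Data.Fin using (Fin; toℕ)
open import Data.Fin.Properties using (_≟_)
open import Data.Vec using (Vec; []; _∷_; lookup)
open import Data.List using (List; []; _∷_; map; concatMap; filter; length; allFin)
open import Data.Product using (Σ; ∃; ∃-syntax; Σ-syntax; _×_; _,_)
open import Data.Sum using (_⊎_)
open import Relation.Binary.PropositionalEquality using (_≡_; _≢_)
open import Relation.Nullary using (¬_)
open import Function.Bundles using (_⇔_)

vecsOver : {A : Set} → List A → (n : ℕ) → List (Vec A n)
vecsOver xs zero    = [] ∷ []
vecsOver xs (suc n) = concatMap (λ x → map (x ∷_) (vecsOver xs n)) xs

allMatrices : (n : ℕ) → List (Vec (Vec Bool n) n)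
allMatrices n = vecsOver (vecsOver (true ∷ false ∷ []) n) n

data Count {A : Set} (P : A → Set) : List A → ℕ → Set where
  c[]   : Count P [] 0
  cyes  : ∀ {x xs m} → P x → Count P xs m → Count P (x ∷ xs) (suc m)
  cno   : ∀ {x xs m} → ¬ P x → Count P xs m → Count P (x ∷ xs) m

Matrix : ℕ → Set
Matrix n = Vec (Vec Bool n) n

Adj : ∀ {n} → Matrix n → Fin n → Fin n → Set
Adj M i j = lookup (lookup M i) j ≡ true

IsGraph : ∀ {n} → Matrix n → Set
IsGraph {n} M = (∀ i → ¬ Adj M i i) × (∀ i j → Adj M i j → Adj M j i)

-- Ordered (k-1)-partitions of [n]: a map part : Fin n → Fin (k-1);
-- class 0 is the labelled class Q₀, the others are Q₁ … Q_{k-2}.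

classSize : ∀ {n c} → (Fin n → Fin c) → Fin c → ℕ
classSize {n} part i = length (filter (λ v → part v ≟ i) (allFin n))

Balanced : ∀ {n c} → (Fin n → Fin c) → Set
Balanced {c = c} part = ∀ (i j : Fin c) → classSize part i ≤ classSize part j + 1

InQ₀ : ∀ {n c} → (Fin n → Fin c) → Fin n → Set
InQ₀ part v = toℕ (part v) ≡ 0

module _ {n : ℕ} (E : Fin n → Fin n → Set) where

  data Reach : Fin n → Fin n → Set where
    here : ∀ {u} → Reach u u
    step : ∀ {u w v} → E u w → Reach w v → Reach u v

  IsStar : (Fin n → Set) → Set
  IsStar C = ∃[ c ] (C c × (∀ u v → C u → C v → (E u v ⇔ (u ≢ v × (u ≡ c ⊎ v ≡ c)))))

  IsClique : (Fin n → Set) → Set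
  IsClique C = ∀ u v → C u → C v → u ≢ v → E u v

  IsTriangle : (Fin n → Set) → Set
  IsTriangle C = ∃[ a ] ∃[ b ] ∃[ c ] (a ≢ b × b ≢ c × a ≢ c
    × (∀ v → C v ⇔ (v ≡ a ⊎ v ≡ b ⊎ v ≡ c)) × IsClique C)

  -- sun: single vertex, or partition into A (inB = false) and B (inB = true)
  -- with edges exactly the pairs having at most one end in B
  IsSun : (Fin n → Set) → Set
  IsSun C = (∃[ c ] (∀ v → C v ⇔ (v ≡ c)))
    ⊎ (Σ[ inB ∈ (Fin n → Bool) ] (∀ u v → C u → C v → u ≢ v
          → (E u v ⇔ (¬ (inB u ≡ true × inB v ≡ true)))))

  Comp : Fin n → Fin n → Set
  Comp u v = Reach u v

coE : ∀ {n c} → (Fin n → Fin c) → Matrix n → Fin n → Fin n → Set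
coE part M u v = InQ₀ part u × InQ₀ part v × u ≢ v × ¬ Adj M u v

AllComps : ∀ {n} (S : Fin n → Set) (E : Fin n → Fin n → Set)
  → ((Fin n → Set) → Set) → Set
AllComps S E X = ∀ u → S u → X (Comp E u)

CompCond : ℕ → ∀ {n} → (Fin n → Fin n → Set) → (Fin n → Set) → Set
CompCond 4 E C = IsSun E C
CompCond 5 E C = IsStar E C ⊎ IsClique E C
CompCond _ E C = IsStar E C ⊎ IsTriangle E C

IsTemplate : (k : ℕ) → ∀ {n c} → (Fin n → Fin c) → Matrix n → Set
IsTemplate k part M = IsGraph M
  × (∀ u v → part u ≡ part v → ¬ InQ₀ part u → u ≢ v → Adj M u v)
  × AllComps (InQ₀ part) (coE part M) (CompCond k (coE part M))

NonTrivialAt : ∀ {n} → (Fin n → Fin n → Set) → Fin n → Set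
NonTrivialAt E u = ∃[ w ] (w ≢ u × Reach E u w)

AtMostOneNontrivial : ∀ {n c} → (Fin n → Fin c) → Matrix n → Set
AtMostOneNontrivial part M =
  ∀ u v → InQ₀ part u → InQ₀ part v
  → NonTrivialAt (coE part M) u → NonTrivialAt (coE part M) v
  → Reach (coE part M) u v

module Submission where

-- We inject (exceptional G, bit string w ∈ {0,1}ⁿ) into all templates.
-- Reconstruction: every allowed component (sun, star, clique, triangle)
-- has on each edge an endpoint dominating the component; so if all
-- non-isolated vertices of H are in one component, H is determined by two
-- bits per vertex of Q₀ (non-isolated? blocked?).  Encoding: keep G off
-- Q₀ × Q₀ and replace H by a star forest with c = 2^B centres whose leaf j
-- hangs at centre f j; stars are always allowed, and the result determines
-- G off Q₀ and f.  Counting: take for f the base-c digits of (w, profiles);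
-- balancedness gives |Q₀| ≥ n/(k-1) - 1, room for all n + 2|Q₀| bits, and
-- a pigeonhole argument yields b · 2ⁿ ≤ t.

open import Defs
open import Data.Bool using (Bool; true; false; not; if_then_else_)
import Data.Bool.Properties as Boolₚ
open import Data.Empty using (⊥-elim)
open import Data.Fin using (Fin; zero; suc; toℕ; fromℕ<; combine)
open import Data.Fin.Properties
  using (_≟_; any?; toℕ-injective; toℕ<n; toℕ-fromℕ<; combine-injective)
open import Data.List
  using (List; []; _∷_; map; concatMap; filter; length; _++_; allFin; cartesianProductWith; cartesianProduct)
import Data.List as List
open import Data.List.Properties using (length-map; length-++; length-tabulate; filter-all)
open import Data.List.Membership.Propositional using (_∈_)
open import Data.List.Membership.Propositional.Properties
  using (∈-lookup; ∈-filter⁺; ∈-filter⁻; ∈-allFin; ∈-cartesianProductWith⁺; ∈-cartesianProduct⁻)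
open import Data.List.Relation.Binary.Subset.Propositional using (_⊆_)
open import Data.List.Relation.Unary.All as All using (All; []; _∷_)
import Data.List.Relation.Unary.All.Properties as Allₚ
open import Data.List.Relation.Unary.AllPairs using ([]; _∷_)
open import Data.List.Relation.Unary.Any as Any using (here; there)
open import Data.List.Relation.Unary.Any.Properties using (lookup-index)
open import Data.List.Relation.Unary.Unique.Propositional using (Unique)
import Data.List.Relation.Unary.Unique.Propositional.Properties as Uniqueₚ
open import Data.Nat using (ℕ; zero; suc; _≤_; _<_; _+_; _*_; _∸_; _^_; _<?_; z≤n; s≤s; s≤s⁻¹; NonZero)
import Data.Nat.Properties as ℕₚ
open import Data.Nat.Properties
  using (≤-trans; ≤-reflexive; <-≤-trans; +-comm; *-comm; +-mono-≤; +-monoˡ-≤; +-monoʳ-≤; +-monoʳ-<;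
         *-cancelˡ-≤; m≤n*m; m≤n+m; m+n≤o⇒m≤o∸n; *-distribˡ-∸; m+[n∸m]≡n; ^-monoʳ-≤; ^-*-assoc;
         m^n≢0; module ≤-Reasoning)
open import Algebra.Properties.CommutativeMonoid.Sum ℕₚ.+-0-commutativeMonoid
  using (sum; sum-cong-≗; sum-replicate-zero; ∑-distrib-+)
open import Data.Nat.DivMod using (_/_; _%_; m≡m%n+[m/n]*n; m%n<n; m<n*o⇒m/o<n)
open import Data.Nat.Solver using (module +-*-Solver)
open import Data.Product using (∃-syntax; _×_; _,_; proj₁; proj₂; uncurry)
open import Data.Sum using (_⊎_; inj₁; inj₂; [_,_]′; swap)
open import Data.Vec using (Vec; []; _∷_; lookup; tabulate)
import Data.Vec as Vec
import Data.Vec.Properties as Vecₚ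
open import Function using (_∘_; const)
open import Function.Bundles using (_⇔_; mk⇔; Equivalence)
import Function.Properties.Equivalence as ⇔
open import Relation.Binary.Definitions using (DecidableEquality)
open import Relation.Binary.PropositionalEquality
  using (_≡_; _≢_; refl; sym; trans; cong; cong₂; subst; subst₂; ≢-sym; module ≡-Reasoning)
open import Relation.Nullary using (¬_; Dec; does; yes; no; ¬?)
open import Relation.Nullary.Decidable using (_×-dec_; _⊎-dec_)

open Equivalence using (to; from)

does≡⇒⇔ : ∀ {P Q : Set} (p? : Dec P) (q? : Dec Q) → does p? ≡ does q? → P ⇔ Q
does≡⇒⇔ (yes p) (yes q) _ = mk⇔ (const q) (const p)
does≡⇒⇔ (no ¬p) (no ¬q) _ = mk⇔ (⊥-elim ∘ ¬p) (⊥-elim ∘ ¬q)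

true⇔true⇒≡ : ∀ {x y : Bool} → (x ≡ true ⇔ y ≡ true) → x ≡ y
true⇔true⇒≡ {true} {true} _ = refl
true⇔true⇒≡ {false} {false} _ = refl
true⇔true⇒≡ {true} {false} x⇔y with () ← to x⇔y refl
true⇔true⇒≡ {false} {true} x⇔y with () ← from x⇔y refl

does≡true⇔ : ∀ {P : Set} (p? : Dec P) → (does p? ≡ true) ⇔ P
does≡true⇔ (yes p) = mk⇔ (const p) (const refl)
does≡true⇔ (no ¬p) = mk⇔ (λ ()) (⊥-elim ∘ ¬p)

if-yes : ∀ {P A : Set} (p? : Dec P) {x y : A} → P → (if does p? then x else y) ≡ x
if-yes (yes _) _ = refl
if-yes (no ¬p) p = ⊥-elim (¬p p)

if-no : ∀ {P A : Set} (p? : Dec P) {x y : A} → ¬ P → (if does p? then x else y) ≡ y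
if-no (yes p) ¬p = ⊥-elim (¬p p)
if-no (no _) _ = refl


module _ {A : Set} where

  count⇒witnesses : ∀ {P : A → Set} {xs b} → Unique xs → Count P xs b
    → ∃[ ps ] (length ps ≡ b × Unique ps × All P ps × ps ⊆ xs)
  count⇒witnesses u c[] = [] , refl , [] , [] , λ ()
  count⇒witnesses (x∉xs ∷ u) (cyes {x} px c) with count⇒witnesses u c
  ... | ps , refl , ups , aps , ps⊆xs =
    x ∷ ps , refl , All.tabulate (λ x∈ps x≡ → All.lookup x∉xs (ps⊆xs x∈ps) x≡) ∷ ups , px ∷ aps ,
    λ { (here e) → here e ; (there y∈ps) → there (ps⊆xs y∈ps) }
  count⇒witnesses (_ ∷ u) (cno _ c) with count⇒witnesses u c
  ... | ps , l , ups , aps , ps⊆xs = ps , l , ups , aps , λ y∈ps → there (ps⊆xs y∈ps)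

  module _ (_≟_ : DecidableEquality A) where

    remove : A → List A → List A
    remove x = filter (λ y → ¬? (y ≟ x))

    length≤1+remove : ∀ x {ys} → Unique ys → length ys ≤ suc (length (remove x ys))
    length≤1+remove x {[]} _ = z≤n
    length≤1+remove x {y ∷ ys} (y∉ys ∷ u) with y ≟ x
    ... | yes refl = ≤-reflexive (cong (λ zs → suc (length zs))
                       (sym (filter-all (λ z → ¬? (z ≟ x)) (All.map ≢-sym y∉ys))))
    ... | no _ = s≤s (length≤1+remove x u)

    unique⊆⇒length≤count : ∀ {Q : A → Set} {xs t} → Count Q xs t
      → ∀ {ys} → Unique ys → All Q ys → ys ⊆ xs → length ys ≤ t
    unique⊆⇒length≤count c[] {[]} _ _ _ = z≤n
    unique⊆⇒length≤count c[] {_ ∷ _} _ _ ys⊆[] with ys⊆[] (here refl)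
    ... | ()
    unique⊆⇒length≤count (cyes {x} _ c) {ys} u qys ys⊆x∷xs =
      ≤-trans (length≤1+remove x u)
        (s≤s (unique⊆⇒length≤count c (Uniqueₚ.filter⁺ _ u) (Allₚ.filter⁺ _ qys) rest⊆xs))
      where
      rest⊆xs : remove x ys ⊆ _
      rest⊆xs y∈rest with ∈-filter⁻ (λ y → ¬? (y ≟ x)) {xs = ys} y∈rest
      ... | y∈ys , y≢x with ys⊆x∷xs y∈ys
      ... | here refl = ⊥-elim (y≢x refl)
      ... | there y∈xs = y∈xs
    unique⊆⇒length≤count (cno ¬qx c) u qys ys⊆x∷xs = unique⊆⇒length≤count c u qys ys⊆xs
      where
      ys⊆xs : _ ⊆ _
      ys⊆xs y∈ys with ys⊆x∷xs y∈ys
      ... | here refl = ⊥-elim (¬qx (All.lookup qys y∈ys))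
      ... | there y∈xs = y∈xs

unique-map : ∀ {A B : Set} (f : A → B) {xs} → Unique xs
  → (∀ {x y} → x ∈ xs → y ∈ xs → f x ≡ f y → x ≡ y) → Unique (map f xs)
unique-map f [] _ = []
unique-map f (x∉xs ∷ u) inj =
  Allₚ.map⁺ (All.tabulate (λ y∈xs fx≡fy → All.lookup x∉xs y∈xs (inj (here refl) (there y∈xs) fx≡fy)))
  ∷ unique-map f u (λ x∈xs y∈xs → inj (there x∈xs) (there y∈xs))

module _ {A B C : Set} (f : A → B → C) where

  length-cartesianProductWith : ∀ xs ys
    → length (cartesianProductWith f xs ys) ≡ length xs * length ys
  length-cartesianProductWith [] ys = refl
  length-cartesianProductWith (x ∷ xs) ys = begin
    length (map (f x) ys ++ cartesianProductWith f xs ys)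
      ≡⟨ length-++ (map (f x) ys) ⟩
    length (map (f x) ys) + length (cartesianProductWith f xs ys)
      ≡⟨ cong₂ _+_ (length-map (f x) ys) (length-cartesianProductWith xs ys) ⟩
    length ys + length xs * length ys ∎
    where open ≡-Reasoning

  concatMap≡cartesianProductWith : ∀ xs ys
    → concatMap (λ x → map (f x) ys) xs ≡ cartesianProductWith f xs ys
  concatMap≡cartesianProductWith [] ys = refl
  concatMap≡cartesianProductWith (x ∷ xs) ys =
    cong (map (f x) ys ++_) (concatMap≡cartesianProductWith xs ys)

module _ {A : Set} (xs : List A) where

  -- Defs builds vecsOver with concatMap; the library calls it a cartesian product.
  vecsOver-suc : ∀ n → vecsOver xs (suc n) ≡ cartesianProductWith _∷_ xs (vecsOver xs n)
  vecsOver-suc n = concatMap≡cartesianProductWith _∷_ xs (vecsOver xs n)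

  vecsOver-complete : (∀ a → a ∈ xs) → ∀ n (v : Vec A n) → v ∈ vecsOver xs n
  vecsOver-complete all∈ zero [] = here refl
  vecsOver-complete all∈ (suc n) (a ∷ v) rewrite vecsOver-suc n =
    ∈-cartesianProductWith⁺ _∷_ (all∈ a) (vecsOver-complete all∈ n v)

  vecsOver-unique : Unique xs → ∀ n → Unique (vecsOver xs n)
  vecsOver-unique u zero = [] ∷ []
  vecsOver-unique u (suc n) rewrite vecsOver-suc n =
    Uniqueₚ.cartesianProductWith⁺ _∷_ Vecₚ.∷-injective u (vecsOver-unique u n)

  length-vecsOver : ∀ n → length (vecsOver xs n) ≡ length xs ^ n
  length-vecsOver zero = refl
  length-vecsOver (suc n) rewrite vecsOver-suc n =
    trans (length-cartesianProductWith _∷_ xs (vecsOver xs n))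
          (cong (length xs *_) (length-vecsOver n))

bools : List Bool
bools = true ∷ false ∷ []

bitVectors : (n : ℕ) → List (Vec Bool n)
bitVectors = vecsOver bools

bools-complete : ∀ b → b ∈ bools
bools-complete true = here refl
bools-complete false = there (here refl)

bools-unique : Unique bools
bools-unique = ((λ ()) ∷ []) ∷ [] ∷ []

matrices-complete : ∀ n (M : Matrix n) → M ∈ allMatrices n
matrices-complete n = vecsOver-complete (bitVectors n) (vecsOver-complete bools bools-complete n) n

matrices-unique : ∀ n → Unique (allMatrices n)
matrices-unique n = vecsOver-unique (bitVectors n) (vecsOver-unique bools bools-unique n) n


bit : Bool → Fin 2
bit false = zero
bit true = suc zero

bit-injective : ∀ {a b} → bit a ≡ bit b → a ≡ b
bit-injective {false} {false} _ = refl
bit-injective {true} {true} _ = refl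

binary : ∀ {l} → Vec Bool l → Fin (2 ^ l)
binary [] = zero
binary (b ∷ v) = combine (bit b) (binary v)

binary-injective : ∀ {l} (v v′ : Vec Bool l) → binary v ≡ binary v′ → v ≡ v′
binary-injective [] [] _ = refl
binary-injective (b ∷ v) (b′ ∷ v′) eq with combine-injective (bit b) (binary v) (bit b′) (binary v′) eq
... | eq₁ , eq₂ = cong₂ _∷_ (bit-injective eq₁) (binary-injective v v′ eq₂)

module Digits (c : ℕ) .{{_ : NonZero c}} where

  digit : ℕ → ℕ → ℕ
  digit N zero = N % c
  digit N (suc j) = digit (N / c) j

  digit<base : ∀ N j → digit N j < c
  digit<base N zero = m%n<n N c
  digit<base N (suc j) = digit<base (N / c) j

  digits-injective : ∀ L {N N′} → N < c ^ L → N′ < c ^ L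
    → (∀ j → j < L → digit N j ≡ digit N′ j) → N ≡ N′
  digits-injective zero {zero} {zero} _ _ _ = refl
  digits-injective zero {suc _} (s≤s ()) _ _
  digits-injective zero {_} {suc _} _ (s≤s ()) _
  digits-injective (suc L) {N} {N′} N< N′< same =
    trans (m≡m%n+[m/n]*n N c)
      (trans (cong₂ (λ r q → r + q * c) (same 0 (s≤s z≤n)) quotients)
             (sym (m≡m%n+[m/n]*n N′ c)))
    where
    quotient< : ∀ {M} → M < c ^ suc L → M / c < c ^ L
    quotient< {M} M< = m<n*o⇒m/o<n (subst (M <_) (*-comm c (c ^ L)) M<)
    quotients : N / c ≡ N′ / c
    quotients = digits-injective L (quotient< N<) (quotient< N′<) (λ j j<L → same (suc j) (s≤s j<L))


indicator : ∀ {K} → Fin K → Fin K → ℕ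
indicator i j = if does (i ≟ j) then 1 else 0

sum-indicator : ∀ {K} (i : Fin K) → sum (indicator i) ≡ 1
sum-indicator {suc K} zero = cong suc (sum-replicate-zero K)
sum-indicator {suc K} (suc i) = sum-indicator i

sum≤ : ∀ {K} (f : Fin K → ℕ) {B} → (∀ j → f j ≤ B) → sum f ≤ K * B
sum≤ {zero} f _ = z≤n
sum≤ {suc K} f f≤ = +-mono-≤ (f≤ zero) (sum≤ (λ j → f (suc j)) (λ j → f≤ (suc j)))

module _ {n K : ℕ} (part : Fin n → Fin K) where

  inClass : Fin K → List (Fin n) → List (Fin n)
  inClass j = filter (λ v → part v ≟ j)

  sum-classSizes : ∀ xs → sum (λ j → length (inClass j xs)) ≡ length xs
  sum-classSizes [] = sum-replicate-zero K
  sum-classSizes (x ∷ xs) = begin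
    sum (λ j → length (inClass j (x ∷ xs)))
      ≡⟨ sum-cong-≗ split ⟩
    sum (λ j → indicator (part x) j + length (inClass j xs))
      ≡⟨ ∑-distrib-+ (indicator (part x)) (λ j → length (inClass j xs)) ⟩
    sum (indicator (part x)) + sum (λ j → length (inClass j xs))
      ≡⟨ cong₂ _+_ (sum-indicator (part x)) (sum-classSizes xs) ⟩
    suc (length xs) ∎
    where
    open ≡-Reasoning
    split : ∀ j → length (inClass j (x ∷ xs)) ≡ indicator (part x) j + length (inClass j xs)
    split j with part x ≟ j
    ... | yes _ = refl
    ... | no _ = refl

  balanced⇒n≤ : Balanced part → ∀ i → n ≤ K * suc (classSize part i)
  balanced⇒n≤ balanced i = begin
    n                           ≡⟨ length-tabulate (λ v → v) ⟨
    length (allFin n)           ≡⟨ sum-classSizes (allFin n) ⟨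
    sum (classSize part)        ≤⟨ sum≤ (classSize part) (λ j → ≤-trans (balanced j i) (≤-reflexive (+-comm _ 1))) ⟩
    K * suc (classSize part i)  ∎
    where open ≤-Reasoning


lookup-injective : ∀ {A : Set} {xs : List A} → Unique xs → ∀ s t → List.lookup xs s ≡ List.lookup xs t → s ≡ t
lookup-injective {xs = _ ∷ _} _ zero zero _ = refl
lookup-injective {xs = _ ∷ _} (x∉xs ∷ _) zero (suc t) eq = ⊥-elim (All.lookup x∉xs (∈-lookup t) eq)
lookup-injective {xs = _ ∷ _} (x∉xs ∷ _) (suc s) zero eq = ⊥-elim (All.lookup x∉xs (∈-lookup s) (sym eq))
lookup-injective {xs = _ ∷ _} (_ ∷ u) (suc s) (suc t) eq = cong suc (lookup-injective u s t eq)

module ClassEnumeration {n K : ℕ} (part : Fin n → Fin K) (i : Fin K) where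

  size : ℕ
  size = classSize part i

  vertex : Fin size → Fin n
  vertex = List.lookup (inClass part i (allFin n))

  vertex-inClass : ∀ t → part (vertex t) ≡ i
  vertex-inClass t = proj₂ (∈-filter⁻ (λ v → part v ≟ i) {xs = allFin n} (∈-lookup t))

  vertex-injective : ∀ s t → vertex s ≡ vertex t → s ≡ t
  vertex-injective = lookup-injective (Uniqueₚ.filter⁺ (λ v → part v ≟ i) (Uniqueₚ.allFin⁺ n))

  vertex-surjective : ∀ v → part v ≡ i → ∃[ t ] vertex t ≡ v
  vertex-surjective v v∈Qᵢ = Any.index v∈ , sym (lookup-index v∈)
    where v∈ = ∈-filter⁺ (λ v → part v ≟ i) (∈-allFin v) v∈Qᵢ

  position : Fin n → ℕ
  position v with part v ≟ i
  ... | yes v∈Qᵢ = toℕ (proj₁ (vertex-surjective v v∈Qᵢ))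
  ... | no _ = 0

  position-vertex : ∀ t → position (vertex t) ≡ toℕ t
  position-vertex t with part (vertex t) ≟ i
  ... | yes v∈Qᵢ = cong toℕ (vertex-injective _ t (proj₂ (vertex-surjective (vertex t) v∈Qᵢ)))
  ... | no v∉Qᵢ = ⊥-elim (v∉Qᵢ (vertex-inClass t))

  enumerated : ∀ v → part v ≡ i → ∃[ t ] (vertex t ≡ v × toℕ t ≡ position v)
  enumerated v v∈Qᵢ with vertex-surjective v v∈Qᵢ
  ... | t , refl = t , refl , sym (position-vertex t)

  position-injective : ∀ u v → part u ≡ i → part v ≡ i → position u ≡ position v → u ≡ v
  position-injective u v u∈Qᵢ v∈Qᵢ eq with enumerated u u∈Qᵢ | enumerated v v∈Qᵢ
  ... | s , refl , s≡ | t , refl , t≡ = cong vertex (toℕ-injective (trans s≡ (trans eq (sym t≡))))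

  vertexAt : ∀ {a} → a < size → Fin n
  vertexAt a<size = vertex (fromℕ< a<size)

  vertexAt-inClass : ∀ {a} (a<size : a < size) → part (vertexAt a<size) ≡ i
  vertexAt-inClass a<size = vertex-inClass (fromℕ< a<size)

  position-vertexAt : ∀ {a} (a<size : a < size) → position (vertexAt a<size) ≡ a
  position-vertexAt a<size = trans (position-vertex _) (toℕ-fromℕ< a<size)


module _ {n : ℕ} (E : Fin n → Fin n → Set) (C : Fin n → Set) where

  Dominates : Fin n → Set
  Dominates x = ∀ z → C z → z ≢ x → E x z

  DominatedEdges : Set
  DominatedEdges = ∀ u v → C u → C v → u ≢ v → E u v → Dominates u ⊎ Dominates v

  -- the second alternative of IsSun: C splits into A and B, and two
  -- vertices of C are adjacent iff at most one of them lies in B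
  SunSplit : (Fin n → Bool) → Set
  SunSplit inB = ∀ u v → C u → C v → u ≢ v → (E u v ⇔ (¬ (inB u ≡ true × inB v ≡ true)))

  sunSplit-A-dominates : ∀ {inB} → SunSplit inB → ∀ x → C x → inB x ≡ false → Dominates x
  sunSplit-A-dominates sun x x∈C x∈A z z∈C z≢x =
    from (sun x z x∈C z∈C (≢-sym z≢x)) λ { (x∈B , _) → false≢true (trans (sym x∈A) x∈B) }
    where
    false≢true : false ≢ true
    false≢true ()

  sun⇒dominated : IsSun E C → DominatedEdges
  sun⇒dominated (inj₁ (c , C≡c)) u v u∈C v∈C u≢v _ =
    ⊥-elim (u≢v (trans (to (C≡c u) u∈C) (sym (to (C≡c v) v∈C))))
  sun⇒dominated (inj₂ (inB , sun)) u v u∈C v∈C u≢v uv with inB u in u∈? | inB v in v∈?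
  ... | false | _     = inj₁ (sunSplit-A-dominates sun u u∈C u∈?)
  ... | true  | false = inj₂ (sunSplit-A-dominates sun v v∈C v∈?)
  ... | true  | true  = ⊥-elim (to (sun u v u∈C v∈C u≢v) uv (u∈? , v∈?))

  -- the third component of IsStar: C is a star with centre c
  StarAt : Fin n → Set
  StarAt c = ∀ u v → C u → C v → (E u v ⇔ (u ≢ v × (u ≡ c ⊎ v ≡ c)))

  starAt-centre-dominates : ∀ {c} → StarAt c → C c → Dominates c
  starAt-centre-dominates star c∈C z z∈C z≢c = from (star _ z c∈C z∈C) (≢-sym z≢c , inj₁ refl)

  star⇒dominated : IsStar E C → DominatedEdges
  star⇒dominated (c , c∈C , star) u v u∈C v∈C _ uv with to (star u v u∈C v∈C) uv
  ... | _ , inj₁ refl = inj₁ (starAt-centre-dominates star c∈C)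
  ... | _ , inj₂ refl = inj₂ (starAt-centre-dominates star c∈C)

  clique⇒dominated : IsClique E C → DominatedEdges
  clique⇒dominated clique u v u∈C _ _ _ = inj₁ (λ z z∈C z≢u → clique u z u∈C z∈C (≢-sym z≢u))

  triangle⇒dominated : IsTriangle E C → DominatedEdges
  triangle⇒dominated (_ , _ , _ , _ , _ , _ , _ , clique) = clique⇒dominated clique

  -- A star is a sun: put every vertex but the centre into B.
  star⇒sun : IsStar E C → IsSun E C
  star⇒sun (c , c∈C , star) = inj₂ (isLeaf , split)
    where
    isLeaf : Fin n → Bool
    isLeaf x = not (does (x ≟ c))
    centre-notLeaf : ¬ (isLeaf c ≡ true)
    centre-notLeaf with c ≟ c
    ... | yes _ = λ ()
    ... | no c≢c = ⊥-elim (c≢c refl)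
    notBothLeaves : ∀ {a b} → a ≡ c ⊎ b ≡ c → ¬ (isLeaf a ≡ true × isLeaf b ≡ true)
    notBothLeaves (inj₁ refl) (a-leaf , _) = centre-notLeaf a-leaf
    notBothLeaves (inj₂ refl) (_ , b-leaf) = centre-notLeaf b-leaf
    adjacent : ∀ a b → C a → C b → a ≢ b → ¬ (isLeaf a ≡ true × isLeaf b ≡ true) → E a b
    adjacent a b a∈C b∈C a≢b notBoth with a ≟ c | b ≟ c
    ... | yes refl | _ = from (star a b a∈C b∈C) (a≢b , inj₁ refl)
    ... | no _ | yes refl = from (star a b a∈C b∈C) (a≢b , inj₂ refl)
    ... | no _ | no _ = ⊥-elim (notBoth (refl , refl))
    split : SunSplit isLeaf
    split a b a∈C b∈C a≢b = mk⇔ (λ ab → notBothLeaves (proj₂ (to (star a b a∈C b∈C) ab)))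
                                (adjacent a b a∈C b∈C a≢b)

-- Components allowed in a k-template have dominated edges … (for k < 4,
-- CompCond falls back to the clause for k ≥ 6)
compCond⇒dominated : ∀ k {n} {E : Fin n → Fin n → Set} {C} → CompCond k E C → DominatedEdges E C
compCond⇒dominated 0 = [ star⇒dominated _ _ , triangle⇒dominated _ _ ]′
compCond⇒dominated 1 = [ star⇒dominated _ _ , triangle⇒dominated _ _ ]′
compCond⇒dominated 2 = [ star⇒dominated _ _ , triangle⇒dominated _ _ ]′
compCond⇒dominated 3 = [ star⇒dominated _ _ , triangle⇒dominated _ _ ]′
compCond⇒dominated 4 = sun⇒dominated _ _
compCond⇒dominated 5 = [ star⇒dominated _ _ , clique⇒dominated _ _ ]′
compCond⇒dominated (suc (suc (suc (suc (suc (suc _)))))) = [ star⇒dominated _ _ , triangle⇒dominated _ _ ]′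

star⇒compCond : ∀ k {n} {E : Fin n → Fin n → Set} {C} → IsStar E C → CompCond k E C
star⇒compCond 0 = inj₁
star⇒compCond 1 = inj₁
star⇒compCond 2 = inj₁
star⇒compCond 3 = inj₁
star⇒compCond 4 = star⇒sun _ _
star⇒compCond 5 = inj₁
star⇒compCond (suc (suc (suc (suc (suc (suc _)))))) = inj₁


module Reconstruction (k : ℕ) {n K : ℕ} (part : Fin n → Fin K) where

  Exceptional : Matrix n → Set
  Exceptional M = IsTemplate k part M × AtMostOneNontrivial part M

  adj? : (M : Matrix n) → ∀ u v → Dec (Adj M u v)
  adj? M u v = lookup (lookup M u) v Boolₚ.≟ true

  coE? : (M : Matrix n) → ∀ u v → Dec (coE part M u v)
  coE? M u v = (toℕ (part u) ℕₚ.≟ 0) ×-dec (toℕ (part v) ℕₚ.≟ 0) ×-dec ¬? (u ≟ v) ×-dec ¬? (adj? M u v)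

  coE-sym : ∀ {M} → IsGraph M → ∀ {u v} → coE part M u v → coE part M v u
  coE-sym (_ , symmetric) (u∈Q₀ , v∈Q₀ , u≢v , ¬uv) = v∈Q₀ , u∈Q₀ , ≢-sym u≢v , ¬uv ∘ symmetric _ _

  NonIsolated : Matrix n → Fin n → Set
  NonIsolated M u = ∃[ x ] coE part M u x

  nonIsolated? : (M : Matrix n) → ∀ u → Dec (NonIsolated M u)
  nonIsolated? M u = any? (coE? M u)

  Blocked : Matrix n → Fin n → Set
  Blocked M u = ∃[ x ] (NonIsolated M x × x ≢ u × ¬ coE part M u x)

  blocked? : (M : Matrix n) → ∀ u → Dec (Blocked M u)
  blocked? M u = any? (λ x → nonIsolated? M x ×-dec ¬? (x ≟ u) ×-dec ¬? (coE? M u x))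

  -- In an exceptional template, both ends of a complement edge are
  -- non-isolated and one of them is not blocked: the edge has an end
  -- dominating its component, which contains every non-isolated vertex.
  edge⇒profiles : ∀ {M} → Exceptional M → ∀ {u v} → coE part M u v
    → NonIsolated M u × NonIsolated M v × ¬ (Blocked M u × Blocked M v)
  edge⇒profiles {M} ((graph , _ , components) , oneNontrivial) {u} {v} uv@(u∈Q₀ , _ , u≢v , _) =
    (v , uv) , (u , coE-sym {M} graph uv) , notBoth
    where
    reachable : ∀ {x} → NonIsolated M x → Reach (coE part M) u x
    reachable {x} (z , xz@(x∈Q₀ , _ , x≢z , _)) = oneNontrivial u x u∈Q₀ x∈Q₀
      (v , ≢-sym u≢v , step uv here) (z , ≢-sym x≢z , step xz here)
    notBoth : ¬ (Blocked M u × Blocked M v)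
    notBoth ((x , x-nonIsolated , x≢u , ¬ux) , (y , y-nonIsolated , y≢v , ¬vy))
      with compCond⇒dominated k (components u u∈Q₀) u v here (step uv here) u≢v uv
    ... | inj₁ u-dominates = ¬ux (u-dominates x (reachable x-nonIsolated) x≢u)
    ... | inj₂ v-dominates = ¬vy (v-dominates y (reachable y-nonIsolated) y≢v)

  -- Conversely two non-isolated vertices that are not both blocked are
  -- adjacent: otherwise each one blocks the other.
  profiles⇒edge : ∀ {M} → IsGraph M → ∀ {u v} → InQ₀ part u → InQ₀ part v → u ≢ v
    → NonIsolated M u → NonIsolated M v → ¬ (Blocked M u × Blocked M v) → coE part M u v
  profiles⇒edge {M} graph {u} {v} u∈Q₀ v∈Q₀ u≢v u-nonIsolated v-nonIsolated notBoth with coE? M u v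
  ... | yes uv = uv
  ... | no ¬uv = ⊥-elim (notBoth ((v , v-nonIsolated , ≢-sym u≢v , ¬uv) ,
                                  (u , u-nonIsolated , u≢v , ¬uv ∘ coE-sym {M} graph)))

  SameProfiles : Matrix n → Matrix n → Set
  SameProfiles M M′ = ∀ u → InQ₀ part u
    → (NonIsolated M u ⇔ NonIsolated M′ u) × (Blocked M u ⇔ Blocked M′ u)

  sameProfiles-sym : ∀ {M M′} → SameProfiles M M′ → SameProfiles M′ M
  sameProfiles-sym same u u∈Q₀ = ⇔.sym (proj₁ (same u u∈Q₀)) , ⇔.sym (proj₂ (same u u∈Q₀))

  coE-transfer : ∀ {M M′} → Exceptional M → Exceptional M′ → SameProfiles M M′
    → ∀ {u v} → coE part M u v → coE part M′ u v
  coE-transfer {M} {M′} exc exc′ same {u} {v} uv@(u∈Q₀ , v∈Q₀ , u≢v , _) with edge⇒profiles {M} exc uv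
  ... | u-nonIsolated , v-nonIsolated , notBoth =
    profiles⇒edge {M′} (proj₁ (proj₁ exc′)) u∈Q₀ v∈Q₀ u≢v
      (to (proj₁ (same u u∈Q₀)) u-nonIsolated) (to (proj₁ (same v v∈Q₀)) v-nonIsolated)
      λ { (u-blocked , v-blocked) →
          notBoth (from (proj₂ (same u u∈Q₀)) u-blocked , from (proj₂ (same v v∈Q₀)) v-blocked) }

  adjacency-transfer : ∀ {M M′} → Exceptional M → Exceptional M′ → SameProfiles M M′
    → ∀ {u v} → InQ₀ part u → InQ₀ part v → Adj M u v → Adj M′ u v
  adjacency-transfer {M} {M′} exc exc′ same {u} {v} u∈Q₀ v∈Q₀ uv with adj? M′ u v | u ≟ v
  ... | yes uv′ | _ = uv′
  ... | no _ | yes refl = ⊥-elim (proj₁ (proj₁ (proj₁ exc)) u uv)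
  ... | no ¬uv′ | no u≢v = ⊥-elim (¬uv uv)
    where
    ¬uv : ¬ Adj M u v
    ¬uv = proj₂ (proj₂ (proj₂ (coE-transfer {M′} {M} exc′ exc (sameProfiles-sym {M} {M′} same) (u∈Q₀ , v∈Q₀ , u≢v , ¬uv′))))

  exceptional-determined : ∀ {M M′} → Exceptional M → Exceptional M′ → SameProfiles M M′
    → ∀ {u v} → InQ₀ part u → InQ₀ part v → lookup (lookup M u) v ≡ lookup (lookup M′ u) v
  exceptional-determined {M} {M′} exc exc′ same u∈Q₀ v∈Q₀ = true⇔true⇒≡ (mk⇔
    (adjacency-transfer {M} {M′} exc exc′ same u∈Q₀ v∈Q₀)
    (adjacency-transfer {M′} {M} exc′ exc (sameProfiles-sym {M} {M′} same) u∈Q₀ v∈Q₀))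


inQ₀⇒zero : ∀ {n C} (part : Fin n → Fin (suc C)) {u} → InQ₀ part u → part u ≡ zero
inQ₀⇒zero _ = toℕ-injective

-- Vertices of Q₀ are
-- identified with their positions 0, 1, …, |Q₀| - 1; the positions below c
-- are centres and the position c + j is a leaf attached to the centre f j.
module StarForest {n C : ℕ} (part : Fin n → Fin (suc C)) (c : ℕ) where

  open ClassEnumeration part zero public

  root : (ℕ → ℕ) → ℕ → ℕ
  root f a with a <? c
  ... | yes _ = a
  ... | no _ = f (a ∸ c)

  root-centre : ∀ f {a} → a < c → root f a ≡ a
  root-centre f {a} a<c with a <? c
  ... | yes _ = refl
  ... | no a≮c = ⊥-elim (a≮c a<c)

  root-leaf : ∀ f j → root f (c + j) ≡ f j
  root-leaf f j with c + j <? c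
  ... | yes c+j<c = ⊥-elim (ℕₚ.m+n≮m c j c+j<c)
  ... | no _ = cong f (ℕₚ.m+n∸m≡n c j)

  -- positions a and b are joined in the star forest (when distinct)
  Linked : (ℕ → ℕ) → ℕ → ℕ → Set
  Linked f a b = root f a ≡ root f b × (a < c ⊎ b < c)

  linked? : ∀ f a b → Dec (Linked f a b)
  linked? f a b = (root f a ℕₚ.≟ root f b) ×-dec ((a <? c) ⊎-dec (b <? c))

  linked-sym : ∀ f {a b} → Linked f a b → Linked f b a
  linked-sym f (same , centre) = sym same , swap centre

  InQ₀² : Fin n → Fin n → Set
  InQ₀² u v = part u ≡ zero × part v ≡ zero

  Adjacent : (ℕ → ℕ) → Fin n → Fin n → Set
  Adjacent f u v = u ≢ v × ¬ Linked f (position u) (position v)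

  adjacent? : ∀ f u v → Dec (Adjacent f u v)
  adjacent? f u v = ¬? (u ≟ v) ×-dec ¬? (linked? f (position u) (position v))

  entry : Matrix n → (ℕ → ℕ) → Fin n → Fin n → Bool
  entry M f u v =
    if does ((part u ≟ zero) ×-dec (part v ≟ zero))
    then does (adjacent? f u v)
    else lookup (lookup M u) v

  starForest : Matrix n → (ℕ → ℕ) → Matrix n
  starForest M f = tabulate (λ u → tabulate (entry M f u))

  lookup-starForest : ∀ M f u v → lookup (lookup (starForest M f) u) v ≡ entry M f u v
  lookup-starForest M f u v =
    trans (cong (λ row → lookup row v) (Vecₚ.lookup∘tabulate _ u)) (Vecₚ.lookup∘tabulate _ v)

  starForest-inside : ∀ M f {u v} → InQ₀² u v → Adj (starForest M f) u v ⇔ Adjacent f u v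
  starForest-inside M f {u} {v} both = subst (λ b → (b ≡ true) ⇔ Adjacent f u v) (sym entry≡)
    (does≡true⇔ (adjacent? f u v))
    where
    entry≡ : lookup (lookup (starForest M f) u) v ≡ does (adjacent? f u v)
    entry≡ = trans (lookup-starForest M f u v) (if-yes ((part u ≟ zero) ×-dec (part v ≟ zero)) both)

  starForest-outside : ∀ M f {u v} → ¬ InQ₀² u v
    → lookup (lookup (starForest M f) u) v ≡ lookup (lookup M u) v
  starForest-outside M f {u} {v} notBoth =
    trans (lookup-starForest M f u v) (if-no ((part u ≟ zero) ×-dec (part v ≟ zero)) notBoth)

  starForest-outside⇔ : ∀ M f {u v} → ¬ InQ₀² u v → Adj (starForest M f) u v ⇔ Adj M u v
  starForest-outside⇔ M f notBoth =
    mk⇔ (trans (sym (starForest-outside M f notBoth))) (trans (starForest-outside M f notBoth))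

  coE⇒linked : ∀ M f {u v} → coE part (starForest M f) u v → Linked f (position u) (position v)
  coE⇒linked M f {u} {v} (u∈Q₀ , v∈Q₀ , u≢v , ¬uv) with linked? f (position u) (position v)
  ... | yes linked = linked
  ... | no ¬linked = ⊥-elim (¬uv (from (starForest-inside M f (inQ₀⇒zero part u∈Q₀ , inQ₀⇒zero part v∈Q₀)) (u≢v , ¬linked)))

  linked⇒coE : ∀ M f {u v} → InQ₀² u v → u ≢ v → Linked f (position u) (position v)
    → coE part (starForest M f) u v
  linked⇒coE M f both@(u∈Q₀ , v∈Q₀) u≢v linked =
    cong toℕ u∈Q₀ , cong toℕ v∈Q₀ , u≢v , λ uv → proj₂ (to (starForest-inside M f both) uv) linked

  starForest-graph : ∀ M f → IsGraph M → IsGraph (starForest M f)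
  starForest-graph M f (irreflexive , symmetric) = irreflexive′ , symmetric′
    where
    irreflexive′ : ∀ u → ¬ Adj (starForest M f) u u
    irreflexive′ u uu with part u ≟ zero
    ... | yes u∈Q₀ = proj₁ (to (starForest-inside M f (u∈Q₀ , u∈Q₀)) uu) refl
    ... | no u∉Q₀ = irreflexive u (to (starForest-outside⇔ M f (u∉Q₀ ∘ proj₁)) uu)
    symmetric′ : ∀ u v → Adj (starForest M f) u v → Adj (starForest M f) v u
    symmetric′ u v uv with part u ≟ zero | part v ≟ zero
    ... | yes u∈Q₀ | yes v∈Q₀ with to (starForest-inside M f (u∈Q₀ , v∈Q₀)) uv
    ...   | u≢v , ¬linked = from (starForest-inside M f (v∈Q₀ , u∈Q₀)) (≢-sym u≢v , ¬linked ∘ linked-sym f)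
    symmetric′ u v uv | no u∉Q₀ | _ = from (starForest-outside⇔ M f (u∉Q₀ ∘ proj₂))
      (symmetric u v (to (starForest-outside⇔ M f (u∉Q₀ ∘ proj₁)) uv))
    symmetric′ u v uv | yes _ | no v∉Q₀ = from (starForest-outside⇔ M f (v∉Q₀ ∘ proj₁))
      (symmetric u v (to (starForest-outside⇔ M f (v∉Q₀ ∘ proj₂)) uv))

  -- The classes Q₁, …, Q_{k-2} lie outside Q₀, so their cliques survive.
  starForest-cliques : ∀ M f → (∀ u v → part u ≡ part v → ¬ InQ₀ part u → u ≢ v → Adj M u v)
    → ∀ u v → part u ≡ part v → ¬ InQ₀ part u → u ≢ v → Adj (starForest M f) u v
  starForest-cliques M f cliques u v same u∉Q₀ u≢v =
    from (starForest-outside⇔ M f (u∉Q₀ ∘ cong toℕ ∘ proj₁)) (cliques u v same u∉Q₀ u≢v)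

  -- If every f j is a centre and there are at least c positions, the
  -- complement of the new G[Q₀] is a disjoint union of stars: the star of u
  -- consists of the vertices sharing its root, the centre being the vertex
  -- at position root(u).
  module Stars (M : Matrix n) (f : ℕ → ℕ) (f<c : ∀ j → f j < c) (c≤size : c ≤ size) where

    H : Fin n → Fin n → Set
    H = coE part (starForest M f)

    root<c : ∀ a → root f a < c
    root<c a with a <? c
    ... | yes a<c = a<c
    ... | no _ = f<c (a ∸ c)

    reach⇒sameRoot : ∀ {u w} → part u ≡ zero → Reach H u w
      → part w ≡ zero × root f (position w) ≡ root f (position u)
    reach⇒sameRoot u∈Q₀ here = u∈Q₀ , refl
    reach⇒sameRoot _ (step ux rest) with reach⇒sameRoot (inQ₀⇒zero part (proj₁ (proj₂ ux))) rest
    ... | w∈Q₀ , same = w∈Q₀ , trans same (sym (proj₁ (coE⇒linked M f ux)))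

    root<size : ∀ u → root f (position u) < size
    root<size u = <-≤-trans (root<c (position u)) c≤size

    centre : Fin n → Fin n
    centre u = vertexAt (root<size u)

    centre-inQ₀ : ∀ u → part (centre u) ≡ zero
    centre-inQ₀ u = vertexAt-inClass (root<size u)

    centre-position : ∀ u → position (centre u) ≡ root f (position u)
    centre-position u = position-vertexAt (root<size u)

    centralVertex : ∀ {u a} → part u ≡ zero → Reach H u a → position a < c → a ≡ centre u
    centralVertex {u} {a} u∈Q₀ ua a<c with reach⇒sameRoot u∈Q₀ ua
    ... | a∈Q₀ , same = position-injective a (centre u) a∈Q₀ (centre-inQ₀ u)
      (trans (sym (root-centre f a<c)) (trans same (sym (centre-position u))))

    centre-linked : ∀ {u b} → part u ≡ zero → Reach H u b → Linked f (position (centre u)) (position b)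
    centre-linked {u} u∈Q₀ ub =
      trans (cong (root f) (centre-position u))
        (trans (root-centre f (root<c (position u))) (sym (proj₂ (reach⇒sameRoot u∈Q₀ ub)))) ,
      inj₁ (subst (_< c) (sym (centre-position u)) (root<c (position u)))

    centre-reachable : ∀ {u} → part u ≡ zero → Reach H u (centre u)
    centre-reachable {u} u∈Q₀ = reachCentre (position u <? c)
      where
      reachCentre : Dec (position u < c) → Reach H u (centre u)
      reachCentre (yes u<c) = subst (Reach H u) (centralVertex u∈Q₀ here u<c) here
      reachCentre (no u≮c) = step (linked⇒coE M f (u∈Q₀ , centre-inQ₀ u) u≢centre
                                    (linked-sym f (centre-linked u∈Q₀ here))) here
        where
        u≢centre : u ≢ centre u
        u≢centre u≡centre = u≮c (subst (_< c) (sym (trans (cong position u≡centre) (centre-position u)))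
                                   (root<c (position u)))

    star : ∀ {u} → part u ≡ zero → IsStar H (Comp H u)
    star {u} u∈Q₀ = centre u , centre-reachable u∈Q₀ ,
      λ a b ua ub → mk⇔ (edge⇒centre ua ub) (centre⇒edge ua ub)
      where
      edge⇒centre : ∀ {a b} → Reach H u a → Reach H u b → H a b → a ≢ b × (a ≡ centre u ⊎ b ≡ centre u)
      edge⇒centre ua ub ab@(_ , _ , a≢b , _) with proj₂ (coE⇒linked M f ab)
      ... | inj₁ a<c = a≢b , inj₁ (centralVertex u∈Q₀ ua a<c)
      ... | inj₂ b<c = a≢b , inj₂ (centralVertex u∈Q₀ ub b<c)
      centre⇒edge : ∀ {a b} → Reach H u a → Reach H u b → a ≢ b × (a ≡ centre u ⊎ b ≡ centre u) → H a b
      centre⇒edge ua ub (a≢b , inj₁ refl) =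
        linked⇒coE M f (centre-inQ₀ u , proj₁ (reach⇒sameRoot u∈Q₀ ub)) a≢b (centre-linked u∈Q₀ ub)
      centre⇒edge ua ub (a≢b , inj₂ refl) =
        linked⇒coE M f (proj₁ (reach⇒sameRoot u∈Q₀ ua) , centre-inQ₀ u) a≢b
          (linked-sym f (centre-linked u∈Q₀ ua))

  starForest-template : ∀ k M f → (∀ j → f j < c) → c ≤ size
    → IsTemplate k part M → IsTemplate k part (starForest M f)
  starForest-template k M f f<c c≤size (graph , cliques , _) =
    starForest-graph M f graph , starForest-cliques M f cliques ,
    λ u u∈Q₀ → star⇒compCond k (Stars.star M f f<c c≤size (inQ₀⇒zero part u∈Q₀))

  -- The star forest records f: the leaf at position c + j is linked to f j.
  starForest-decode : ∀ {M M′ f f′} → (∀ j → f j < c) → c ≤ size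
    → starForest M f ≡ starForest M′ f′ → ∀ j → c + j < size → f j ≡ f′ j
  starForest-decode {M} {M′} {f} {f′} f<c c≤size same j c+j<size =
    trans (sym (root-centre f′ (f<c j))) (trans (sym (proj₁ linked′)) (root-leaf f′ j))
    where
    centre<size : f j < size
    centre<size = <-≤-trans (f<c j) c≤size
    leaf centre : Fin n
    leaf = vertexAt c+j<size
    centre = vertexAt centre<size
    leaf≢centre : leaf ≢ centre
    leaf≢centre eq = ℕₚ.<⇒≱ (f<c j) (subst (c ≤_) c+j≡fj (ℕₚ.m≤m+n c j))
      where
      c+j≡fj : c + j ≡ f j
      c+j≡fj = trans (sym (position-vertexAt c+j<size))
                 (trans (cong position eq) (position-vertexAt centre<size))
    linked : Linked f (position leaf) (position centre)
    linked = subst₂ (Linked f) (sym (position-vertexAt c+j<size)) (sym (position-vertexAt centre<size))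
      (trans (root-leaf f j) (sym (root-centre f (f<c j))) , inj₂ (f<c j))
    edge′ : coE part (starForest M′ f′) leaf centre
    edge′ = subst (λ X → coE part X leaf centre) same
      (linked⇒coE M f (vertexAt-inClass c+j<size , vertexAt-inClass centre<size) leaf≢centre linked)
    linked′ : Linked f′ (c + j) (f j)
    linked′ = subst₂ (Linked f′) (position-vertexAt c+j<size) (position-vertexAt centre<size)
      (coE⇒linked M′ f′ edge′)


-- Arithmetic behind the choice of parameters: with B = K + 3 bits per
-- digit, L = m ∸ c digits suffice for n + 2m bits once m ≥ K + B c and
-- n ≤ K (m + 1).
enough-digits : ∀ K m n c → n ≤ K * suc m → K + (K + 3) * c ≤ m
  → n + (m + m) ≤ (K + 3) * (m ∸ c)
enough-digits K m n c n≤ m-large = begin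
  n + (m + m)                      ≤⟨ m+n≤o⇒m≤o∸n (n + (m + m)) bound ⟩
  (K + 3) * m ∸ (K + 3) * c        ≡⟨ *-distribˡ-∸ (K + 3) m c ⟨
  (K + 3) * (m ∸ c)                ∎
  where
  open ≤-Reasoning
  open +-*-Solver
  bound : n + (m + m) + (K + 3) * c ≤ (K + 3) * m
  bound = begin
    n + (m + m) + (K + 3) * c            ≤⟨ +-monoˡ-≤ ((K + 3) * c) (+-monoˡ-≤ (m + m) n≤) ⟩
    K * suc m + (m + m) + (K + 3) * c    ≡⟨ solve 3 (λ K m c → K :* (con 1 :+ m) :+ (m :+ m) :+ (K :+ con 3) :* c
                                                  := K :* m :+ (m :+ m) :+ (K :+ (K :+ con 3) :* c)) refl K m c ⟩
    K * m + (m + m) + (K + (K + 3) * c)  ≤⟨ +-monoʳ-≤ (K * m + (m + m)) m-large ⟩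
    K * m + (m + m) + m                  ≡⟨ solve 2 (λ K m → K :* m :+ (m :+ m) :+ m := (K :+ con 3) :* m) refl K m ⟩
    (K + 3) * m                          ∎

vec-ext : ∀ {A : Set} {l} {xs ys : Vec A l} → (∀ i → lookup xs i ≡ lookup ys i) → xs ≡ ys
vec-ext {xs = xs} {ys} same =
  trans (sym (Vecₚ.tabulate∘lookup xs)) (trans (Vecₚ.tabulate-cong same) (Vecₚ.tabulate∘lookup ys))

matrix-ext : ∀ {n} {M M′ : Matrix n} → (∀ u v → lookup (lookup M u) v ≡ lookup (lookup M′ u) v) → M ≡ M′
matrix-ext same = vec-ext (λ u → vec-ext (same u))

-- Keep M outside Q₀ × Q₀; inside, plant the star forest whose leaf labels
-- are the base-2^B digits of the bit string w followed by the profile of M.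
module Injection (k : ℕ) {n C : ℕ} (part : Fin n → Fin (suc C)) (balanced : Balanced part)
  (n-large : suc C * suc (suc C + (suc C + 3) * 2 ^ (suc C + 3)) ≤ n) where

  open Reconstruction k part
  K B c : ℕ
  K = suc C
  B = K + 3
  c = 2 ^ B
  open StarForest part c
  open Digits c {{m^n≢0 2 B}}

  size-large : K + B * c ≤ size
  size-large = s≤s⁻¹ (*-cancelˡ-≤ K (≤-trans n-large (balanced⇒n≤ part balanced zero)))

  c≤size : c ≤ size
  c≤size = ≤-trans (m≤n*m c B) (≤-trans (m≤n+m (B * c) K) size-large)

  L : ℕ
  L = size ∸ c

  profile : Matrix n → Vec Bool (size + size)
  profile M = tabulate (λ t → does (nonIsolated? M (vertex t))) Vec.++ tabulate (λ t → does (blocked? M (vertex t)))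

  sameProfiles : ∀ M M′ → profile M ≡ profile M′ → SameProfiles M M′
  sameProfiles M M′ same u u∈Q₀ with enumerated u (inQ₀⇒zero part u∈Q₀)
  ... | t , refl , _ =
    does≡⇒⇔ (nonIsolated? M u) (nonIsolated? M′ u) (bitAt (Vecₚ.++-injectiveˡ _ _ same)) ,
    does≡⇒⇔ (blocked? M u) (blocked? M′ u) (bitAt (Vecₚ.++-injectiveʳ _ _ same))
    where
    bitAt : ∀ {g h : Fin size → Bool} → tabulate g ≡ tabulate h → g t ≡ h t
    bitAt {g} {h} eq = trans (sym (Vecₚ.lookup∘tabulate g t))
                         (trans (cong (λ v → lookup v t) eq) (Vecₚ.lookup∘tabulate h t))

  code : Matrix n → Vec Bool n → ℕ
  code M w = toℕ (binary (w Vec.++ profile M))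

  code<c^L : ∀ M w → code M w < c ^ L
  code<c^L M w = <-≤-trans (toℕ<n (binary (w Vec.++ profile M)))
    (≤-trans (^-monoʳ-≤ 2 (enough-digits K size n c (balanced⇒n≤ part balanced zero) size-large))
             (≤-reflexive (sym (^-*-assoc 2 B L))))

  embed : Matrix n → Vec Bool n → Matrix n
  embed M w = starForest M (digit (code M w))

  embed-template : ∀ M w → IsTemplate k part M → IsTemplate k part (embed M w)
  embed-template M w = starForest-template k M (digit (code M w)) (digit<base (code M w)) c≤size

  embed-injective : ∀ {M M′ w w′} → Exceptional M → Exceptional M′
    → embed M w ≡ embed M′ w′ → M ≡ M′ × w ≡ w′
  embed-injective {M} {M′} {w} {w′} exc exc′ same = matrix-ext entries , proj₁ bits
    where
    digits : ∀ j → j < L → digit (code M w) j ≡ digit (code M′ w′) j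
    digits j j<L = starForest-decode {M} {M′} (digit<base (code M w)) c≤size same j
      (subst (c + j <_) (m+[n∸m]≡n c≤size) (+-monoʳ-< c j<L))
    bits : w ≡ w′ × profile M ≡ profile M′
    bits = Vecₚ.++-injective w w′ (binary-injective _ _ (toℕ-injective
             (digits-injective L (code<c^L M w) (code<c^L M′ w′) digits)))
    entries : ∀ u v → lookup (lookup M u) v ≡ lookup (lookup M′ u) v
    entries u v with (part u ≟ zero) ×-dec (part v ≟ zero)
    ... | yes (u∈Q₀ , v∈Q₀) = exceptional-determined {M} {M′} exc exc′ (sameProfiles M M′ (proj₂ bits))
                                 (cong toℕ u∈Q₀) (cong toℕ v∈Q₀)
    ... | no notBoth = trans (sym (starForest-outside M _ notBoth))
                         (trans (cong (λ X → lookup (lookup X u) v) same) (starForest-outside M′ _ notBoth))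

  exceptional-rare : ∀ t b → Count (IsTemplate k part) (allMatrices n) t
    → Count Exceptional (allMatrices n) b → b * 2 ^ n ≤ t
  exceptional-rare t b countT countB with count⇒witnesses (matrices-unique n) countB
  ... | ps , refl , ps-unique , ps-exceptional , _ =
    subst (_≤ t) length-images
      (unique⊆⇒length≤count (Vecₚ.≡-dec (Vecₚ.≡-dec Boolₚ._≟_)) countT images-unique images-templates
        (λ {M} _ → matrices-complete n M))
    where
    pairs : List (Matrix n × Vec Bool n)
    pairs = cartesianProduct ps (bitVectors n)
    images : List (Matrix n)
    images = map (uncurry embed) pairs
    length-images : length images ≡ length ps * 2 ^ n
    length-images = trans (length-map (uncurry embed) pairs)
      (trans (length-cartesianProductWith _,_ ps (bitVectors n)) (cong (length ps *_) (length-vecsOver bools n)))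
    exceptional : ∀ {p} → p ∈ pairs → Exceptional (proj₁ p)
    exceptional p∈ = All.lookup ps-exceptional (proj₁ (∈-cartesianProduct⁻ ps (bitVectors n) p∈))
    images-unique : Unique images
    images-unique = unique-map (uncurry embed)
      (Uniqueₚ.cartesianProduct⁺ ps-unique (vecsOver-unique bools bools-unique n))
      λ p∈ q∈ same → uncurry (cong₂ _,_) (embed-injective (exceptional p∈) (exceptional q∈) same)
    images-templates : All (IsTemplate k part) images
    images-templates = Allₚ.map⁺ (All.tabulate λ {p} p∈ → embed-template (proj₁ p) (proj₂ p) (proj₁ (exceptional p∈)))

proposition4p5 : (k : ℕ) → 4 ≤ k → ∃[ n₀ ] (∀ n → n₀ ≤ n
    → (part : Fin n → Fin (k ∸ 1)) → Balanced part
    → (t b : ℕ)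
    → Count (IsTemplate k part) (allMatrices n) t
    → Count (λ M → IsTemplate k part M × AtMostOneNontrivial part M) (allMatrices n) b
    → b * 2 ^ n ≤ t)
proposition4p5 k@(suc (suc C)) (s≤s (s≤s _)) =
  suc C * suc (suc C + (suc C + 3) * 2 ^ (suc C + 3)) ,
  λ n n-large part balanced → Injection.exceptional-rare k part balanced n-large
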